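{- Let $Q$ be an ice fork, let $j$ be a mutable vertex of $Q$ that is not the point of return, and let $k\ne j$ be another mutable vertex. If $k$ is red or green in $Q$, then $k$ is red or green in $\mu_j(Q)$.
   Context: Quiver: finite directed graph without loops or oriented 2-cycles, vertices partitioned into mutable and frozen, arrows between frozen vertices ignored; $b_{ij}$ = #arrows $i\to j$ − #arrows $j\to i$; mutation $\mu_j$ is standard quiver mutation. Abundant: at least 2 arrows between each pair of vertices at least one mutable. A fork is an abundant, non-acyclic quiver with at most one frozen vertex and a vertex $r$ (point of return) such that $b_{ij}>b_{ri}$ and $b_{ij}>b_{jr}$ whenever $r\to i$ and $j\to r$, and the subquivers induced on $\{i:r\to i\}$ and $\{j:j\to r\}$ are acyclic. A quiver with mutable vertices $[n]$ and frozen $u_1,\dots,u_m$ ($m\ge1$) is an ice fork with point of return $r$ if each $Q|_{[n]\cup\{u_i\}}$ is a fork with point of return $r$. A mutable vertex adjacent to a frozen vertex is red (green) if all arrows between it and frozen vertices point toward (away from) it. -}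

module Defs where

open import Data.Nat as ℕ using (ℕ; suc)
open import Data.Integer as ℤ using (ℤ; +_; -_; _+_; _-_; _*_; _⊔_; _≤_; _<_; ∣_∣)
open import Data.Fin as Fin using (Fin)
open import Data.Fin.Properties using () renaming (_≟_ to _≟F_)
open import Data.Sum using (_⊎_; inj₁; inj₂)
open import Data.Product using (_×_; ∃)
open import Data.Unit using (⊤)
open import Data.Empty using (⊥)
open import Data.Bool using (Bool; true; false; if_then_else_; _∨_)
open import Relation.Nullary using (¬_)
open import Relation.Nullary.Decidable using (⌊_⌋)
open import Relation.Binary.PropositionalEquality using (_≡_; _≢_)

-- Vertices of a quiver with mutable vertices [n] (inj₁) and
-- frozen vertices u_1..u_m (inj₂).
V : ℕ → ℕ → Set
V n m = Fin n ⊎ Fin m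

-- A quiver (no loops, no oriented 2-cycles) is encoded by its
-- exchange matrix b_{xy} = #arrows x→y − #arrows y→x.
Mat : ℕ → ℕ → Set
Mat n m = V n m → V n m → ℤ

IsQuiver : ∀ {n m} → Mat n m → Set
IsQuiver b = ∀ x y → b y x ≡ - b x y

IsMutable : ∀ {n m} → V n m → Set
IsMutable (inj₁ _) = ⊤
IsMutable (inj₂ _) = ⊥

Arrow : ∀ {W : Set} → (W → W → ℤ) → W → W → Set
Arrow b x y = + 0 < b x y

data Path {W : Set} (b : W → W → ℤ) (P : W → Set) : W → W → Set where
  edge : ∀ {x y} → P x → P y → Arrow b x y → Path b P x y
  step : ∀ {x y z} → P x → Arrow b x y → Path b P y z → Path b P x z

HasCycle : ∀ {W : Set} → (W → W → ℤ) → (W → Set) → Set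
HasCycle b P = ∃ λ x → Path b P x x

Acyclic : ∀ {W : Set} → (W → W → ℤ) → (W → Set) → Set
Acyclic b P = ¬ HasCycle b P

Everything : ∀ {W : Set} → W → Set
Everything _ = ⊤

Abundant : ∀ {n m} → Mat n m → Set
Abundant b = ∀ x y → x ≢ y → IsMutable x ⊎ IsMutable y → 2 ℕ.≤ ∣ b x y ∣

record IsFork {n m : ℕ} (b : Mat n m) (r : Fin n) : Set where
  field
    atMostOneFrozen : m ℕ.≤ 1
    abundant        : Abundant b
    notAcyclic      : HasCycle b Everything
    returnIneq      : ∀ i j → Arrow b (inj₁ r) i → Arrow b j (inj₁ r) →
                        (b (inj₁ r) i < b i j) × (b j (inj₁ r) < b i j)
    outAcyclic      : Acyclic b (λ i → Arrow b (inj₁ r) i)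
    inAcyclic       : Acyclic b (λ j → Arrow b j (inj₁ r))

-- full subquiver Q|_{[n] ∪ {u}}
restrictV : ∀ {n m} → Fin m → V n 1 → V n m
restrictV u (inj₁ i) = inj₁ i
restrictV u (inj₂ _) = inj₂ u

restrict : ∀ {n m} → Mat n m → Fin m → Mat n 1
restrict b u x y = b (restrictV u x) (restrictV u y)

record IsIceFork {n m : ℕ} (b : Mat n m) (r : Fin n) : Set where
  field
    someFrozen : 1 ℕ.≤ m
    forks      : ∀ u → IsFork (restrict b u) r

[_]₊ : ℤ → ℤ
[ x ]₊ = x ⊔ + 0

isVertex : ∀ {n m} → Fin n → V n m → Bool
isVertex j (inj₁ i) = ⌊ i ≟F j ⌋
isVertex j (inj₂ _) = false

mutate : ∀ {n m} → Mat n m → Fin n → Mat n m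
mutate b j x y =
  if isVertex j x ∨ isVertex j y
  then - b x y
  else b x y + [ b x (inj₁ j) ]₊ * [ b (inj₁ j) y ]₊
             - [ - b x (inj₁ j) ]₊ * [ - b (inj₁ j) y ]₊

AdjFrozen : ∀ {n m} → Mat n m → Fin n → Set
AdjFrozen b k = ∃ λ u → b (inj₁ k) (inj₂ u) ≢ + 0

Red : ∀ {n m} → Mat n m → Fin n → Set
Red b k = AdjFrozen b k × (∀ u → b (inj₁ k) (inj₂ u) ≤ + 0)

Green : ∀ {n m} → Mat n m → Fin n → Set
Green b k = AdjFrozen b k × (∀ u → + 0 ≤ b (inj₁ k) (inj₂ u))

{-# OPTIONS --safe #-}
-- By abundance every b_{ku} (u frozen) and b_{kj} is nonzero, so k red (green) means
-- b_{ku} < 0 (> 0) for all u, and μ_j adds [b_{kj}]₊[b_{ju}]₊ − [−b_{kj}]₊[−b_{ju}]₊ to b_{ku}.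
-- Reversing all arrows (b ↦ −b) preserves ice forks, commutes with mutation and swaps red
-- and green, so let k be red.  If j → k the row only decreases.  If k → j and k ≠ r, an
-- arrow j → u would close a triangle k → j → u → k avoiding r, which a fork forbids: every
-- other vertex is an in- or out-neighbour of r, the return inequalities forbid arrows from
-- in- to out-neighbours, and both neighbourhoods are acyclic; so the row is unchanged.
-- If k = r, the return inequalities give b_{ju} > b_{rj} > 0 and b_{ju} > b_{ur} = −b_{ru},
-- so b'_{ru} = b_{ru} + b_{rj} b_{ju} > 0 and k turns green.
module Submission where

open import Defs
open import Data.Nat using (ℕ)
open import Data.Fin using (Fin)
import Data.Fin as Fin
open import Data.Sum using (_⊎_)
open import Relation.Binary.PropositionalEquality using (_≢_)

import Data.Nat as ℕ
open import Data.Integer as ℤ using (ℤ; nonNegative; +_; -_; _+_; _-_; _*_; _≤_; _<_; ∣_∣)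
open import Data.Integer.Properties
open import Data.Integer.Tactic.RingSolver using (solve-∀)
open import Data.Fin.Properties using () renaming (_≟_ to _≟F_)
open import Data.Sum as Sum using (inj₁; inj₂)
open import Data.Sum.Properties using (inj₁-injective)
open import Data.Product using (_×_; _,_; proj₁)
open import Data.Unit using (tt)
open import Function using (_∘_)
open import Relation.Binary.Definitions using (tri<; tri≈; tri>)
open import Relation.Nullary using (¬_; yes; no; contradiction)
open import Relation.Binary.PropositionalEquality
  using (_≡_; refl; sym; cong; subst; subst₂)

private
  variable
    n m : ℕ
    W : Set

[x]₊-nonNeg : ∀ x → + 0 ≤ [ x ]₊
[x]₊-nonNeg x = i≤j⊔i x (+ 0)

[x]₊≡0 : ∀ {x} → x ≤ + 0 → [ x ]₊ ≡ + 0
[x]₊≡0 = i≤j⇒i⊔j≡j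

[x]₊≡x : ∀ {x} → + 0 ≤ x → [ x ]₊ ≡ x
[x]₊≡x = i≥j⇒i⊔j≡i

[x]₊*[y]₊-nonNeg : ∀ x y → + 0 ≤ [ x ]₊ * [ y ]₊
[x]₊*[y]₊-nonNeg x y =
  *-monoʳ-≤-nonNeg [ y ]₊ {{nonNegative ([x]₊-nonNeg y)}} ([x]₊-nonNeg x)

abundant⇒≢0 : ∀ {z} → 2 ℕ.≤ ∣ z ∣ → z ≢ + 0
abundant⇒≢0 () refl

≢0⇒<0⊎>0 : ∀ {z} → z ≢ + 0 → z < + 0 ⊎ + 0 < z
≢0⇒<0⊎>0 {z} z≢0 with <-cmp z (+ 0)
... | tri< z<0 _ _ = inj₁ z<0
... | tri≈ _ z≡0 _ = contradiction z≡0 z≢0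
... | tri> _ _ z>0 = inj₂ z>0

q≤p*q : ∀ {p q} → + 0 < p → + 0 ≤ q → q ≤ p * q
q≤p*q {p} {q} 0<p 0≤q =
  subst (_≤ p * q) (*-identityˡ q) (*-monoʳ-≤-nonNeg q {{nonNegative 0≤q}} (i<j⇒suc[i]≤j 0<p))

-- Entry b'_{xy} of μ_j(b) for x, y ≠ j, with a = b_{xy}, p = b_{xj}, q = b_{jy}.
mutateEntry : ℤ → ℤ → ℤ → ℤ
mutateEntry a p q = a + [ p ]₊ * [ q ]₊ - [ - p ]₊ * [ - q ]₊

mutateEntry-≤ : ∀ a {p} q → p ≤ + 0 → mutateEntry a p q ≤ a
mutateEntry-≤ a {p} q p≤0 rewrite [x]₊≡0 p≤0 | +-identityʳ a =
  i-j≤i a _ {{nonNegative ([x]₊*[y]₊-nonNeg (- p) (- q))}}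

mutateEntry-≡ : ∀ a {p q} → + 0 ≤ p → q ≤ + 0 → mutateEntry a p q ≡ a
mutateEntry-≡ a {p} {q} 0≤p q≤0
  rewrite [x]₊≡0 q≤0 | [x]₊≡0 (neg-mono-≤ 0≤p) | *-zeroʳ [ p ]₊ | +-identityʳ a = +-identityʳ a

mutateEntry-pos : ∀ {a p q} → + 0 < p → + 0 < q → - a < q → + 0 < mutateEntry a p q
mutateEntry-pos {a} {p} {q} 0<p 0<q -a<q
  rewrite [x]₊≡x (<⇒≤ 0<p) | [x]₊≡x (<⇒≤ 0<q) | [x]₊≡0 (neg-mono-≤ (<⇒≤ 0<p))
        | +-identityʳ (a + p * q) =
  <-≤-trans (subst (_< a + q) (+-inverseʳ a) (+-monoʳ-< a -a<q))
            (+-monoʳ-≤ a (q≤p*q 0<p (<⇒≤ 0<q)))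

mutateEntry-neg : ∀ a p q → mutateEntry (- a) (- p) (- q) ≡ - mutateEntry a p q
mutateEntry-neg a p q rewrite neg-involutive p | neg-involutive q =
  swap-terms a ([ p ]₊ * [ q ]₊) ([ - p ]₊ * [ - q ]₊)
  where
  swap-terms : ∀ a x y → - a + y - x ≡ - (a + x - y)
  swap-terms = solve-∀

<0⇒arrow : {b : Mat n m} → IsQuiver b → ∀ {x y} → b x y < + 0 → Arrow b y x
<0⇒arrow {b = b} sk {x} {y} b<0 = subst (+ 0 <_) (sym (sk x y)) (neg-mono-< b<0)

arrow⇒<0 : {b : Mat n m} → IsQuiver b → ∀ {x y} → Arrow b x y → b y x < + 0
arrow⇒<0 {b = b} sk {x} {y} b>0 = subst (_< + 0) (sym (sk x y)) (neg-mono-< b>0)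

snoc : {b : W → W → ℤ} {P : W → Set} →
  ∀ {x y z} → Path b P x y → Arrow b y z → P z → Path b P x z
snoc (edge px py xy) yz pz = step px xy (edge py pz yz)
snoc (step px xy p) yz pz = step px xy (snoc p yz pz)

module _ {b c : W → W → ℤ} {P R : W → Set} where

  reverse : (∀ {x y} → Arrow b x y → Arrow c y x) → (∀ {x} → P x → R x) →
            ∀ {x y} → Path b P x y → Path c R y x
  reverse f g (edge px py xy) = edge (g py) (g px) (f xy)
  reverse f g (step px xy p) = snoc (reverse f g p) (f xy) (g px)

  reverseCycle : (∀ {x y} → Arrow b x y → Arrow c y x) → (∀ {x} → P x → R x) →
                 HasCycle b P → HasCycle c R
  reverseCycle f g (x , cycle) = x , reverse f g cycle

opposite : Mat n m → Mat n m
opposite b x y = - b x y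

opposite-isQuiver : {b : Mat n m} → IsQuiver b → IsQuiver (opposite b)
opposite-isQuiver sk x y = cong -_ (sk x y)

opposite-transpose : {b : Mat n m} → IsQuiver b → ∀ x y → opposite b x y ≡ b y x
opposite-transpose sk x y = sym (sk x y)

arrow-opposite : {b : Mat n m} → IsQuiver b → ∀ {x y} → Arrow (opposite b) x y → Arrow b y x
arrow-opposite sk {x} {y} = subst (+ 0 <_) (opposite-transpose sk x y)

opposite-arrow : {b : Mat n m} → IsQuiver b → ∀ {x y} → Arrow b x y → Arrow (opposite b) y x
opposite-arrow sk {x} {y} = subst (+ 0 <_) (sym (opposite-transpose sk y x))

opposite-isFork : {b : Mat n m} {r : Fin n} → IsQuiver b → IsFork b r → IsFork (opposite b) r
opposite-isFork {b = b} {r} sk F = record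
  { atMostOneFrozen = atMostOneFrozen
  ; abundant        = λ x y x≢y mut →
                        subst (2 ℕ.≤_) (sym (∣-i∣≡∣i∣ (b x y))) (abundant x y x≢y mut)
  ; notAcyclic      = reverseCycle (opposite-arrow sk) (λ _ → tt) notAcyclic
  ; returnIneq      = returnIneq-opposite
  ; outAcyclic      = inAcyclic ∘ reverseCycle (arrow-opposite sk) (arrow-opposite sk)
  ; inAcyclic       = outAcyclic ∘ reverseCycle (arrow-opposite sk) (arrow-opposite sk)
  }
  where
  open IsFork F
  returnIneq-opposite : ∀ i j → Arrow (opposite b) (inj₁ r) i → Arrow (opposite b) j (inj₁ r) →
    (opposite b (inj₁ r) i < opposite b i j) × (opposite b j (inj₁ r) < opposite b i j)
  returnIneq-opposite i j r→i j→r
    with returnIneq j i (arrow-opposite sk j→r) (arrow-opposite sk r→i)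
  ... | b[rj]<b[ji] , b[ir]<b[ji] = transport (inj₁ r) i b[ir]<b[ji] , transport j (inj₁ r) b[rj]<b[ji]
    where
    transport : ∀ x y → b y x < b j i → opposite b x y < opposite b i j
    transport x y = subst₂ _<_ (sym (opposite-transpose sk x y)) (sym (opposite-transpose sk i j))

restrict-isQuiver : {b : Mat n m} → IsQuiver b → ∀ u → IsQuiver (restrict b u)
restrict-isQuiver sk u x y = sk (restrictV u x) (restrictV u y)

opposite-isIceFork : {b : Mat n m} {r : Fin n} → IsQuiver b → IsIceFork b r →
  IsIceFork (opposite b) r
opposite-isIceFork sk ice = record
  { someFrozen = someFrozen
  ; forks      = λ u → opposite-isFork (restrict-isQuiver sk u) (forks u)
  }
  where open IsIceFork ice

iceFork-abundant : {b : Mat n m} {r : Fin n} → IsIceFork b r → Abundant b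
iceFork-abundant ice (inj₁ i) (inj₁ i′) i≢i′ _ =
  IsFork.abundant (forks (Fin.fromℕ< someFrozen)) (inj₁ i) (inj₁ i′)
    (i≢i′ ∘ cong inj₁ ∘ inj₁-injective) (inj₁ tt)
  where open IsIceFork ice
iceFork-abundant ice (inj₁ i) (inj₂ u) _ _ =
  IsFork.abundant (IsIceFork.forks ice u) (inj₁ i) (inj₂ Fin.zero) (λ ()) (inj₁ tt)
iceFork-abundant ice (inj₂ u) (inj₁ i) _ _ =
  IsFork.abundant (IsIceFork.forks ice u) (inj₂ Fin.zero) (inj₁ i) (λ ()) (inj₂ tt)
iceFork-abundant ice (inj₂ _) (inj₂ _) _ (inj₁ ())
iceFork-abundant ice (inj₂ _) (inj₂ _) _ (inj₂ ())

module Fork {b : Mat n m} {r : Fin n} (sk : IsQuiver b) (F : IsFork b r) where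
  open IsFork F

  neighbour-of-return : ∀ {x} → x ≢ inj₁ r → Arrow b (inj₁ r) x ⊎ Arrow b x (inj₁ r)
  neighbour-of-return {x} x≢r =
    Sum.swap (Sum.map₁ (<0⇒arrow sk)
      (≢0⇒<0⊎>0 (abundant⇒≢0 (abundant (inj₁ r) x (x≢r ∘ sym) (inj₁ tt)))))

  no-arrow-from-in-to-out : ∀ {x y} → Arrow b x (inj₁ r) → Arrow b (inj₁ r) y → ¬ Arrow b x y
  no-arrow-from-in-to-out {x} {y} x→r r→y x→y =
    <-asym (<-trans r→y (proj₁ (returnIneq y x r→y x→r))) (arrow⇒<0 sk x→y)

  in-neighbours-closed : ∀ {x y} → y ≢ inj₁ r →
    Arrow b x (inj₁ r) → Arrow b x y → Arrow b y (inj₁ r)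
  in-neighbours-closed y≢r x→r x→y with neighbour-of-return y≢r
  ... | inj₁ r→y = contradiction x→y (no-arrow-from-in-to-out x→r r→y)
  ... | inj₂ y→r = y→r

  out-neighbours-closed : ∀ {x y} → x ≢ inj₁ r →
    Arrow b (inj₁ r) y → Arrow b x y → Arrow b (inj₁ r) x
  out-neighbours-closed x≢r r→y x→y with neighbour-of-return x≢r
  ... | inj₁ r→x = r→x
  ... | inj₂ x→r = contradiction x→y (no-arrow-from-in-to-out x→r r→y)

  no-triangle-avoiding-return : ∀ {x y z} → x ≢ inj₁ r → y ≢ inj₁ r → z ≢ inj₁ r →
    Arrow b x y → Arrow b y z → ¬ Arrow b z x
  no-triangle-avoiding-return x≢r y≢r z≢r x→y y→z z→x with neighbour-of-return x≢r
  ... | inj₂ x→r = inAcyclic (_ , step x→r x→y (step y→r y→z (edge z→r x→r z→x)))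
    where
    y→r = in-neighbours-closed y≢r x→r x→y
    z→r = in-neighbours-closed z≢r y→r y→z
  ... | inj₁ r→x = outAcyclic (_ , step r→x x→y (step r→y y→z (edge r→z r→x z→x)))
    where
    r→z = out-neighbours-closed z≢r r→x z→x
    r→y = out-neighbours-closed y≢r r→z y→z

row : Mat n m → Fin n → Fin m → ℤ
row b k u = b (inj₁ k) (inj₂ u)

AllNegative AllPositive : (Fin m → ℤ) → Set
AllNegative f = ∀ u → f u < + 0
AllPositive f = ∀ u → + 0 < f u

mutatedRow : Mat n m → Fin n → Fin n → Fin m → ℤ
mutatedRow b j k u = mutateEntry (row b k u) (b (inj₁ k) (inj₁ j)) (row b j u)

row-mutate : {b : Mat n m} {j k : Fin n} → k ≢ j →
  ∀ u → row (mutate b j) k u ≡ mutatedRow b j k u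
row-mutate {j = j} {k} k≢j u with k ≟F j
... | yes k≡j = contradiction k≡j k≢j
... | no _ = refl

mutatedRow-red : {b : Mat n m} {r j k : Fin n} → IsQuiver b → IsIceFork b r → j ≢ r → k ≢ j →
  AllNegative (row b k) → AllNegative (mutatedRow b j k) ⊎ AllPositive (mutatedRow b j k)
mutatedRow-red {b = b} {r} {j} {k} sk ice j≢r k≢j u→k
  with ≢0⇒<0⊎>0 (abundant⇒≢0 (iceFork-abundant ice (inj₁ k) (inj₁ j) (k≢j ∘ inj₁-injective) (inj₁ tt)))
     | k ≟F r
... | inj₁ j→k | _ = inj₁ λ u → ≤-<-trans (mutateEntry-≤ (row b k u) (row b j u) (<⇒≤ j→k)) (u→k u)
... | inj₂ k→j | no k≢r =
  inj₁ λ u → subst (_< + 0) (sym (mutateEntry-≡ _ (<⇒≤ k→j) (j↛u u))) (u→k u)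
  where
  open IsIceFork ice
  j↛u : ∀ u → row b j u ≤ + 0
  j↛u u = ≮⇒≥ λ j→u → Fork.no-triangle-avoiding-return (restrict-isQuiver {b = b} sk u) (forks u)
    {inj₁ k} {inj₁ j} {inj₂ Fin.zero}
    (k≢r ∘ inj₁-injective) (j≢r ∘ inj₁-injective) (λ ()) k→j j→u (<0⇒arrow {b = b} sk (u→k u))
... | inj₂ r→j | yes refl = inj₂ λ u → flipped u
  where
  open IsIceFork ice
  flipped : ∀ u → + 0 < mutatedRow b j k u
  flipped u with IsFork.returnIneq (forks u) (inj₁ j) (inj₂ Fin.zero) r→j (<0⇒arrow sk (u→k u))
  ... | b[rj]<b[ju] , b[ur]<b[ju] = mutateEntry-pos r→j (<-trans r→j b[rj]<b[ju])
    (subst (_< row b j u) (sk (inj₁ k) (inj₂ u)) b[ur]<b[ju])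

mutatedRow-green : {b : Mat n m} {r j k : Fin n} → IsQuiver b → IsIceFork b r → j ≢ r → k ≢ j →
  AllPositive (row b k) → AllPositive (mutatedRow b j k) ⊎ AllNegative (mutatedRow b j k)
mutatedRow-green {b = b} {r} {j} {k} sk ice j≢r k≢j k→u =
  Sum.map (λ neg u → neg-cancel-< (subst (_< + 0) (negate u) (neg u)))
          (λ pos u → neg-cancel-< (subst (+ 0 <_) (negate u) (pos u)))
          (mutatedRow-red (opposite-isQuiver sk) (opposite-isIceFork sk ice) j≢r k≢j (neg-mono-< ∘ k→u))
  where
  negate : ∀ u → mutatedRow (opposite b) j k u ≡ - mutatedRow b j k u
  negate u = mutateEntry-neg (row b k u) (b (inj₁ k) (inj₁ j)) (row b j u)

red⇒allNegative : {b : Mat n m} {k : Fin n} → (∀ u → 2 ℕ.≤ ∣ row b k u ∣) →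
  Red b k → AllNegative (row b k)
red⇒allNegative ab (_ , ≤0) u = ≤∧≢⇒< (≤0 u) (abundant⇒≢0 (ab u))

green⇒allPositive : {b : Mat n m} {k : Fin n} → (∀ u → 2 ℕ.≤ ∣ row b k u ∣) →
  Green b k → AllPositive (row b k)
green⇒allPositive ab (_ , ≥0) u = ≤∧≢⇒< (≥0 u) (abundant⇒≢0 (ab u) ∘ sym)

mutate-redOrGreen : {b : Mat n m} {j k : Fin n} → k ≢ j → Fin m →
  AllNegative (mutatedRow b j k) ⊎ AllPositive (mutatedRow b j k) →
  Red (mutate b j) k ⊎ Green (mutate b j) k
mutate-redOrGreen {b = b} {j} {k} k≢j u₀ = Sum.map
  (λ neg → (u₀ , <⇒≢ (row-neg neg u₀)) , <⇒≤ ∘ row-neg neg)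
  (λ pos → (u₀ , <⇒≢ (row-pos pos u₀) ∘ sym) , <⇒≤ ∘ row-pos pos)
  where
  row-neg : AllNegative (mutatedRow b j k) → AllNegative (row (mutate b j) k)
  row-neg neg u = subst (_< + 0) (sym (row-mutate {b = b} k≢j u)) (neg u)
  row-pos : AllPositive (mutatedRow b j k) → AllPositive (row (mutate b j) k)
  row-pos pos u = subst (+ 0 <_) (sym (row-mutate {b = b} k≢j u)) (pos u)

lemma3p15 : ∀ {n m : ℕ} (b : Mat n m) (r : Fin n) → IsQuiver b → IsIceFork b r →
    (j k : Fin n) → j ≢ r → k ≢ j →
    Red b k ⊎ Green b k → Red (mutate b j) k ⊎ Green (mutate b j) k
lemma3p15 b r sk ice j k j≢r k≢j = Sum.[ fromRed , fromGreen ]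
  where
  frozenAbundant : ∀ u → 2 ℕ.≤ ∣ row b k u ∣
  frozenAbundant u = iceFork-abundant ice (inj₁ k) (inj₂ u) (λ ()) (inj₁ tt)

  fromRed : Red b k → Red (mutate b j) k ⊎ Green (mutate b j) k
  fromRed red@((u₀ , _) , _) = mutate-redOrGreen {b = b} k≢j u₀
    (mutatedRow-red sk ice j≢r k≢j (red⇒allNegative {b = b} frozenAbundant red))

  fromGreen : Green b k → Red (mutate b j) k ⊎ Green (mutate b j) k
  fromGreen green@((u₀ , _) , _) = mutate-redOrGreen {b = b} k≢j u₀
    (Sum.swap (mutatedRow-green sk ice j≢r k≢j (green⇒allPositive {b = b} frozenAbundant green)))
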